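{- For $N\ge 0$ let $a_N$ be the number of tilings of the $5\times \tfrac{3N}{5}$ rectangle by $1\times 3$ tiles when $3N/5$ is a positive integer, $a_N=0$ when $3N/5$ is not an integer, and $a_0=1$. Then $$\sum_{N\ge 0} a_N z^N=\frac{(1-z^5)^2}{1-6z^5+3z^{10}-z^{15}} = 1+4z^5+22z^{10}+121z^{15}+664z^{20}+\cdots.$$
   Context: A tiling of an $m\times n$ rectangle (made of $mn$ unit squares) by $a\times b$ tiles is a set of non-overlapping axis-parallel $a\times b$ or $b\times a$ rectangles with integer corners whose union is the rectangle; both orientations may be mixed. Tilings related by a symmetry of the rectangle are counted separately. The index $N$ is the number of tiles used. -}

module Defs where

open import Data.Bool using (Bool; true; false; _∧_; if_then_else_; T)
open import Data.Nat using (ℕ; zero; suc; _+_; _*_; _∸_; _≤ᵇ_; _<ᵇ_; _≡ᵇ_)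
open import Data.Fin using (Fin; toℕ)
open import Data.List using (List; []; _∷_; allFin; map; upTo; concatMap)
open import Data.Bool.ListAction using (all)
open import Data.Nat.ListAction using (sum)
open import Data.Vec using (Vec; lookup)
open import Data.Product using (Σ)
open import Data.Integer using (ℤ; +_; -[1+_])
import Data.Integer as ℤ
import Data.List as L

-- Tilings of an m × n rectangle (m rows, n columns) by 1×3 tiles.
--
-- A tile placement is given by an orientation o : Fin 2
--   (zero = horizontal 1×3, i.e. one row and three columns;
--    suc zero = vertical 3×1, i.e. three rows and one column)
-- and the cell (i , j) of its top-left corner.
-- A tiling is the set of placed tiles, encoded as a selection
--   s : Vec (Vec (Vec Bool n) m) 2,  s[o][i][j] = true  iff the tile
-- with orientation o and top-left corner (i , j) belongs to the tiling,
-- such that every selected tile lies inside the rectangle and every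
-- unit cell is covered by exactly one selected tile.

Selection : ℕ → ℕ → Set
Selection m n = Vec (Vec (Vec Bool n) m) 2

selected : ∀ {m n} → Selection m n → Fin 2 → Fin m → Fin n → Bool
selected s o i j = lookup (lookup (lookup s o) i) j

isHorizontal : Fin 2 → Bool
isHorizontal Fin.zero = true
isHorizontal (Fin.suc _) = false

fits : ℕ → ℕ → Fin 2 → ℕ → ℕ → Bool
fits m n o i j = if isHorizontal o then (j + 3 ≤ᵇ n) else (i + 3 ≤ᵇ m)

covers : Fin 2 → ℕ → ℕ → ℕ → ℕ → Bool
covers o i j r c =
  if isHorizontal o
  then ((r ≡ᵇ i) ∧ ((j ≤ᵇ c) ∧ (c <ᵇ j + 3)))
  else ((c ≡ᵇ j) ∧ ((i ≤ᵇ r) ∧ (r <ᵇ i + 3)))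

coverCount : ∀ {m n} → Selection m n → Fin m → Fin n → ℕ
coverCount {m} {n} s r c =
  sum (concatMap (λ o → concatMap (λ i → map (λ j →
        if selected s o i j ∧ covers o (toℕ i) (toℕ j) (toℕ r) (toℕ c)
        then 1 else 0) (allFin n)) (allFin m)) (allFin 2))

isTiling : (m n : ℕ) → Selection m n → Bool
isTiling m n s =
  all (λ o → all (λ i → all (λ j →
         if selected s o i j then fits m n o (toℕ i) (toℕ j) else true)
       (allFin n)) (allFin m)) (allFin 2)
  ∧ all (λ r → all (λ c → coverCount s r c ≡ᵇ 1) (allFin n)) (allFin m)

Tiling : ℕ → ℕ → Set
Tiling m n = Σ (Selection m n) (λ s → T (isTiling m n s))

Series : Set
Series = ℕ → ℤ

_⊛_ : Series → Series → Series
(f ⊛ g) N = L.foldr ℤ._+_ (+ 0) (map (λ k → f k ℤ.* g (N ∸ k)) (upTo (suc N)))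

poly : List ℤ → Series
poly [] N = + 0
poly (c ∷ cs) zero = c
poly (c ∷ cs) (suc N) = poly cs N

z5poly : ℤ → ℤ → ℤ → ℤ → List ℤ
z5poly a b c d = a ∷ z ∷ z ∷ z ∷ z ∷ b ∷ z ∷ z ∷ z ∷ z ∷ c ∷ z ∷ z ∷ z ∷ z ∷ d ∷ []
  where z = + 0

-- numerator (1 - z⁵)² = 1 - 2 z⁵ + z¹⁰
numerator : Series
numerator = poly (z5poly (+ 1) (ℤ.- (+ 2)) (+ 1) (+ 0))

denominator : Series
denominator = poly (z5poly (+ 1) (ℤ.- (+ 6)) (+ 3) (ℤ.- (+ 1)))

-- Scanning the rectangle column by column, a tiling of the 5 × k rectangle is
-- the same as a word of k columns accepted by a finite automaton whose state
-- records, for each row, whether its cell in the column about to be read is the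
-- second or the third cell of a horizontal tile. The number c_k(q) of accepted words from a state q
-- satisfies c_{k+1}(q) = Σ c_k(q′) over the successors q′, a linear map of c_k.
-- So the recurrence c_{k+9} − 6 c_{k+6} + 3 c_{k+3} − c_k = 0, checked by
-- computation at k = 0 simultaneously for all 4⁵ states, holds for all k. As
-- three columns correspond to z⁵, multiplying the generating series by
-- 1 − 6z⁵ + 3z¹⁰ − z¹⁵ leaves nothing beyond degree 15, and the first fifteen
-- coefficients of the product are computed directly.

module Submission where

open import Defs
open import Data.Bool using (Bool; true; false; _∧_; _∨_; not; if_then_else_; T)
open import Data.Bool.Properties using (T-∧; ∧-zeroʳ; T-irrelevant)
open import Data.Bool.ListAction using (all)
open import Data.Nat using (ℕ; zero; suc; _+_; _*_; _∸_; _<_; _<?_; _≡ᵇ_; _≤ᵇ_; _<ᵇ_)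
open import Data.Nat.Properties
  using (+-assoc; +-comm; +-identityʳ; *-comm; *-zeroʳ; *-cancelˡ-≡; ≡ᵇ⇒≡; ≡⇒≡ᵇ; ≮⇒≥; m≤n⇒∃[o]m+o≡n)
open import Data.Nat.Divisibility using (_∣_; divides; ∣-refl; ∣-trans; ∣m∣n⇒∣m+n; n∣m*n)
open import Data.Nat.Coprimality using (coprime?; coprime-divisor)
open import Data.Nat.ListAction using (sum)
open import Data.Nat.ListAction.Properties using (sum-++)
open import Data.Nat.Tactic.RingSolver using (solve-∀)
open import Data.Integer as ℤ using (ℤ; +_)
import Data.Integer.Properties as ℤ
import Data.Integer.Tactic.RingSolver as ℤ
open import Data.Fin using (Fin; toℕ; fromℕ<; zero; suc)
open import Data.Fin.Patterns using (0F; 1F; 2F; 3F; 4F)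
open import Data.Fin.Properties using (+↔⊎; 0↔⊥; 1↔⊤; all?; toℕ-fromℕ<)
open import Data.List using (List; []; _∷_; map; concatMap; allFin; foldr)
open import Data.List.Properties using (map-tabulate; map-cong; map-applyUpTo)
open import Data.List.Relation.Unary.All.Properties using (all⁺; all⁻; tabulate⁺; tabulate⁻)
open import Data.Vec using (Vec; []; _∷_; lookup; tabulate; replicate)
open import Data.Vec.Properties using (lookup∘tabulate; tabulate∘lookup; tabulate-cong; lookup-replicate)
open import Data.Product using (Σ; _×_; _,_; proj₁; proj₂)
open import Data.Product.Function.Dependent.Propositional using (Σ-↔)
open import Data.Product.Function.NonDependent.Propositional using (_×-⇔_)
open import Data.Sum using (_⊎_; inj₁; inj₂)
open import Data.Sum.Function.Propositional using (_⊎-↔_)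
open import Data.Empty using (⊥)
open import Data.Unit using (tt)
open import Function.Base using (_∘_)
open import Function.Bundles using (_↔_; mk↔ₛ′; _⇔_; mk⇔; Equivalence)
open import Function.Properties.Equivalence using () renaming (trans to ⇔-trans)
open import Function.Properties.Inverse using (↔-refl; ↔-sym; ↔-trans)
open import Relation.Nullary using (¬_; yes; no)
open import Relation.Nullary.Decidable using (from-yes)
open import Relation.Binary.PropositionalEquality using (_≡_; refl; sym; trans; cong; cong₂; subst; module ≡-Reasoning)

bit : Bool → ℕ
bit true = 1
bit false = 0

when : Bool → ℕ → ℕ
when b n = if b then n else 0

sumBool² : (Bool → Bool → ℕ) → ℕ
sumBool² f = f false false + (f false true + (f true false + f true true))

andBool² : (Bool → Bool → Bool) → Bool
andBool² f = f false false ∧ (f false true ∧ (f true false ∧ f true true))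

Σ-Bool²-↔ : ∀ {F : Bool × Bool → Set} →
  Σ (Bool × Bool) F ↔ (F (false , false) ⊎ (F (false , true) ⊎ (F (true , false) ⊎ F (true , true))))
Σ-Bool²-↔ = mk↔ₛ′
  (λ { ((false , false) , x) → inj₁ x ; ((false , true) , x) → inj₂ (inj₁ x)
     ; ((true , false) , x) → inj₂ (inj₂ (inj₁ x)) ; ((true , true) , x) → inj₂ (inj₂ (inj₂ x)) })
  (λ { (inj₁ x) → _ , x ; (inj₂ (inj₁ x)) → _ , x
     ; (inj₂ (inj₂ (inj₁ x))) → _ , x ; (inj₂ (inj₂ (inj₂ x))) → _ , x })
  (λ { (inj₁ x) → refl ; (inj₂ (inj₁ x)) → refl
     ; (inj₂ (inj₂ (inj₁ x))) → refl ; (inj₂ (inj₂ (inj₂ x))) → refl })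
  (λ { ((false , false) , x) → refl ; ((false , true) , x) → refl
     ; ((true , false) , x) → refl ; ((true , true) , x) → refl })

Σ-Vec[]-↔ : ∀ {A : Set} {F : Vec A 0 → Set} → Σ (Vec A 0) F ↔ F []
Σ-Vec[]-↔ = mk↔ₛ′ (λ { ([] , x) → x }) ([] ,_) (λ _ → refl) (λ { ([] , x) → refl })

Σ-Vec∷-↔ : ∀ {A : Set} {n} {F : Vec A (suc n) → Set} →
  Σ (Vec A (suc n)) F ↔ Σ A (λ a → Σ (Vec A n) (λ v → F (a ∷ v)))
Σ-Vec∷-↔ = mk↔ₛ′ (λ { ((a ∷ v) , x) → a , v , x }) (λ { (a , v , x) → a ∷ v , x })
  (λ _ → refl) (λ { ((a ∷ v) , x) → refl })

⊥×-↔ : ∀ {A : Set} → (⊥ × A) ↔ ⊥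
⊥×-↔ = mk↔ₛ′ proj₁ (λ ()) (λ ()) (λ { (() , _) })

Σ-⊥×-↔ : ∀ {A : Set} {G : A → Set} → Σ A (λ a → ⊥ × G a) ↔ Fin 0
Σ-⊥×-↔ = mk↔ₛ′ (λ { (_ , () , _) }) (λ ()) (λ ()) (λ { (_ , () , _) })

T∧-Σ-↔ : ∀ b {A : Set} {P : A → Bool} → Σ A (λ a → T (b ∧ P a)) ↔ (T b × Σ A (λ a → T (P a)))
T∧-Σ-↔ false = mk↔ₛ′ (λ { (_ , ()) }) (λ { (() , _) }) (λ { (() , _) }) (λ { (_ , ()) })
T∧-Σ-↔ true = mk↔ₛ′ (tt ,_) proj₂ (λ _ → refl) (λ _ → refl)

⊎-Fin-↔ : ∀ {A B : Set} {m n} → A ↔ Fin m → B ↔ Fin n → (A ⊎ B) ↔ Fin (m + n)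
⊎-Fin-↔ A↔m B↔n = ↔-trans (A↔m ⊎-↔ B↔n) (↔-sym +↔⊎)

-- The column automaton

-- A state entry (a , b) of a row records whether the cell of that row in the
-- current column is the third (a) or the second (b) cell of a horizontal tile;
-- a column entry (h , v) whether a horizontal (h) or vertical (v) tile has its
-- top-left corner at that cell.
State : ℕ → Set
State n = Vec (Bool × Bool) n

Column : ℕ → Set
Column n = Vec (Bool × Bool) n

empty : ∀ {n} → State n
empty = replicate _ (false , false)

-- x and y: a vertical tile has its corner one (x) or two (y) rows above the cell.
coveredOnce : Bool → Bool → Bool → Bool → Bool → Bool → Bool
coveredOnce a b h v x y = (bit a + bit b + bit h + bit v + bit x + bit y) ≡ᵇ 1

valid : ∀ {n} → State n → Bool → Bool → Column n → Bool
valid [] x y [] = not (x ∨ y)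
valid ((a , b) ∷ q) x y ((h , v) ∷ c) = coveredOnce a b h v x y ∧ valid q v x c

next : ∀ {n} → State n → Column n → State n
next [] [] = []
next ((a , b) ∷ q) ((h , v) ∷ c) = (b , h) ∷ next q c

isFinal : ∀ {n} → State n → Bool
isFinal [] = true
isFinal ((a , b) ∷ q) = not (a ∨ b) ∧ isFinal q

accepts : ∀ {n k} → State n → Vec (Column n) k → Bool
accepts q [] = isFinal q
accepts q (c ∷ w) = valid q false false c ∧ accepts (next q c) w

Accepted : ∀ {n} → ℕ → State n → Set
Accepted {n} k q = Σ (Vec (Column n) k) (λ w → T (accepts q w))

-- Choosing the column row by row discards invalid columns
-- early, which keeps the counts below small enough to compute by evaluation.
sumOverSteps : ∀ {n} → State n → Bool → Bool → (State n → ℕ) → ℕ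
sumOverSteps [] x y K = when (not (x ∨ y)) (K [])
sumOverSteps ((a , b) ∷ q) x y K =
  sumBool² λ h v → when (coveredOnce a b h v x y) (sumOverSteps q v x (λ q′ → K ((b , h) ∷ q′)))

countAccepted : ∀ {n} → ℕ → State n → ℕ
countAccepted zero q = if isFinal q then 1 else 0
countAccepted (suc k) q = sumOverSteps q false false (countAccepted k)

T-when-↔ : ∀ b {A : Set} {m} → A ↔ Fin m → (T b × A) ↔ Fin (when b m)
T-when-↔ false A↔m = ↔-trans ⊥×-↔ (↔-sym 0↔⊥)
T-when-↔ true A↔m = ↔-trans (mk↔ₛ′ proj₂ (tt ,_) (λ _ → refl) (λ _ → refl)) A↔m

sumOverSteps-↔ : ∀ {n} (q : State n) x y {F : State n → Set} {K : State n → ℕ} →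
  (∀ q′ → F q′ ↔ Fin (K q′)) →
  Σ (Column n) (λ c → T (valid q x y c) × F (next q c)) ↔ Fin (sumOverSteps q x y K)
sumOverSteps-↔ [] x y F↔K = ↔-trans Σ-Vec[]-↔ (T-when-↔ (not (x ∨ y)) (F↔K []))
sumOverSteps-↔ {suc n} ((a , b) ∷ q) x y {F} {K} F↔K =
  ↔-trans Σ-Vec∷-↔ (↔-trans Σ-Bool²-↔
    (⊎-Fin-↔ (branch false false)
      (⊎-Fin-↔ (branch false true) (⊎-Fin-↔ (branch true false) (branch true true)))))
  where
  branch : ∀ h v →
    Σ (Column n) (λ c → T (coveredOnce a b h v x y ∧ valid q v x c) × F ((b , h) ∷ next q c))
      ↔ Fin (when (coveredOnce a b h v x y) (sumOverSteps q v x (λ q′ → K ((b , h) ∷ q′))))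
  branch h v with coveredOnce a b h v x y
  ... | false = Σ-⊥×-↔
  ... | true = sumOverSteps-↔ q v x (λ q′ → F↔K ((b , h) ∷ q′))

Accepted↔Fin : ∀ {n} k (q : State n) → Accepted k q ↔ Fin (countAccepted k q)
Accepted↔Fin zero q = ↔-trans Σ-Vec[]-↔ (final (isFinal q))
  where
  final : ∀ b → T b ↔ Fin (if b then 1 else 0)
  final true = ↔-sym 1↔⊤
  final false = ↔-sym 0↔⊥
Accepted↔Fin (suc k) q =
  ↔-trans Σ-Vec∷-↔ (↔-trans (Σ-↔ ↔-refl λ {c} → T∧-Σ-↔ (valid q false false c))
                            (sumOverSteps-↔ q false false (Accepted↔Fin k)))

when-linear : ∀ b m s t → when b (m * s + t) ≡ m * when b s + when b t
when-linear false m s t = sym (cong (_+ 0) (*-zeroʳ m))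
when-linear true m s t = refl

sumBool²-linear : ∀ m (f g : Bool → Bool → ℕ) →
  sumBool² (λ h v → m * f h v + g h v) ≡ m * sumBool² f + sumBool² g
sumBool²-linear m f g = distribute m (f false false) (f false true) (f true false) (f true true)
                                     (g false false) (g false true) (g true false) (g true true)
  where
  distribute : ∀ m a b c d a′ b′ c′ d′ →
    (m * a + a′) + ((m * b + b′) + ((m * c + c′) + (m * d + d′)))
      ≡ m * (a + (b + (c + d))) + (a′ + (b′ + (c′ + d′)))
  distribute = solve-∀

sumBool²-cong : ∀ {f g : Bool → Bool → ℕ} → (∀ h v → f h v ≡ g h v) → sumBool² f ≡ sumBool² g
sumBool²-cong f≡g = cong₂ _+_ (f≡g _ _) (cong₂ _+_ (f≡g _ _) (cong₂ _+_ (f≡g _ _) (f≡g _ _)))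

sumOverSteps-cong : ∀ {n} (q : State n) x y {K L : State n → ℕ} →
  (∀ q′ → K q′ ≡ L q′) → sumOverSteps q x y K ≡ sumOverSteps q x y L
sumOverSteps-cong [] x y K≡L = cong (when (not (x ∨ y))) (K≡L [])
sumOverSteps-cong ((a , b) ∷ q) x y K≡L = sumBool²-cong λ h v →
  cong (when (coveredOnce a b h v x y)) (sumOverSteps-cong q v x (λ q′ → K≡L ((b , h) ∷ q′)))

sumOverSteps-linear : ∀ {n} (q : State n) x y m (K L : State n → ℕ) →
  sumOverSteps q x y (λ q′ → m * K q′ + L q′) ≡ m * sumOverSteps q x y K + sumOverSteps q x y L
sumOverSteps-linear [] x y m K L = when-linear (not (x ∨ y)) m (K []) (L [])
sumOverSteps-linear ((a , b) ∷ q) x y m K L = trans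
  (sumBool²-cong λ h v → trans
    (cong (when (coveredOnce a b h v x y)) (sumOverSteps-linear q v x m (K ∘ ((b , h) ∷_)) (L ∘ ((b , h) ∷_))))
    (when-linear (coveredOnce a b h v x y) m _ _))
  (sumBool²-linear m (successorSum K) (successorSum L))
  where
  successorSum : (State _ → ℕ) → Bool → Bool → ℕ
  successorSum M h v = when (coveredOnce a b h v x y) (sumOverSteps q v x (M ∘ ((b , h) ∷_)))

andBool²-sound : ∀ f → T (andBool² f) → ∀ a b → T (f a b)
andBool²-sound f t = corner
  where
  t₁ : T (f false false) × T (f false true ∧ (f true false ∧ f true true))
  t₁ = Equivalence.to (T-∧ {f false false}) t
  t₂ : T (f false true) × T (f true false ∧ f true true)
  t₂ = Equivalence.to (T-∧ {f false true}) (proj₂ t₁)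
  t₃ : T (f true false) × T (f true true)
  t₃ = Equivalence.to (T-∧ {f true false}) (proj₂ t₂)
  corner : ∀ a b → T (f a b)
  corner false false = proj₁ t₁
  corner false true = proj₁ t₂
  corner true false = proj₁ t₃
  corner true true = proj₂ t₃

allStates : ∀ n → (State n → Bool) → Bool
allStates zero P = P []
allStates (suc n) P = andBool² λ a b → allStates n (λ q → P ((a , b) ∷ q))

allStates-sound : ∀ n (P : State n → Bool) → T (allStates n P) → ∀ q → T (P q)
allStates-sound zero P t [] = t
allStates-sound (suc n) P t ((a , b) ∷ q) =
  allStates-sound n (λ q′ → P ((a , b) ∷ q′))
    (andBool²-sound (λ a b → allStates n (λ q′ → P ((a , b) ∷ q′))) t a b) q

CountRecurrence : ℕ → Set
CountRecurrence k = ∀ (q : State 5) →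
  3 * countAccepted (3 + k) q + countAccepted (9 + k) q ≡ 6 * countAccepted (6 + k) q + countAccepted k q

countAccepted-recurrence : ∀ k → CountRecurrence k
countAccepted-recurrence zero q = ≡ᵇ⇒≡ _ _ (allStates-sound 5 holdsAt0 _ q)
  where
  holdsAt0 : State 5 → Bool
  holdsAt0 q = 3 * countAccepted 3 q + countAccepted 9 q ≡ᵇ 6 * countAccepted 6 q + countAccepted 0 q
countAccepted-recurrence (suc k) q = begin
  3 * S (countAccepted (3 + k)) + S (countAccepted (9 + k))
    ≡⟨ sym (sumOverSteps-linear q false false 3 _ _) ⟩
  S (λ q′ → 3 * countAccepted (3 + k) q′ + countAccepted (9 + k) q′)
    ≡⟨ sumOverSteps-cong q false false (countAccepted-recurrence k) ⟩
  S (λ q′ → 6 * countAccepted (6 + k) q′ + countAccepted k q′)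
    ≡⟨ sumOverSteps-linear q false false 6 _ _ ⟩
  6 * S (countAccepted (6 + k)) + S (countAccepted k) ∎
  where
  open ≡-Reasoning
  S : (State 5 → ℕ) → ℕ
  S = sumOverSteps q false false

-- Tilings as accepted words

pattern horizontal = 0F
pattern vertical = 1F

Corners : ℕ → ℕ → Set
Corners m k = Fin 2 → Fin m → Fin k → Bool

dropColumn : ∀ {m k} → Corners m (suc k) → Corners m k
dropColumn S o i j = S o i (suc j)

firstColumn : ∀ {m k} → Corners m (suc k) → Column m
firstColumn S = tabulate λ i → S horizontal i zero , S vertical i zero

columns : ∀ {m k} → Corners m k → Vec (Column m) k
columns {k = zero} S = []
columns {k = suc k} S = firstColumn S ∷ columns (dropColumn S)

cornerOf : ∀ {m} → Column m → Corners m 1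
cornerOf c horizontal i _ = proj₁ (lookup c i)
cornerOf c vertical i _ = proj₂ (lookup c i)

toSelection : ∀ {m k} → Vec (Column m) k → Selection m k
toSelection w = tabulate λ o → tabulate λ i → tabulate λ j → cornerOf (lookup w j) o i zero

columns-cong : ∀ {m k} {S S′ : Corners m k} → (∀ o i j → S o i j ≡ S′ o i j) → columns S ≡ columns S′
columns-cong {k = zero} S≡S′ = refl
columns-cong {k = suc k} S≡S′ =
  cong₂ _∷_ (tabulate-cong λ i → cong₂ _,_ (S≡S′ horizontal i zero) (S≡S′ vertical i zero))
            (columns-cong λ o i j → S≡S′ o i (suc j))

columns-toSelection : ∀ {m k} (w : Vec (Column m) k) → columns (selected (toSelection w)) ≡ w
columns-toSelection {m} w = trans (columns-cong selected-toSelection) (columns-lookup w)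
  where
  selected-toSelection : ∀ o i j → selected (toSelection w) o i j ≡ cornerOf (lookup w j) o i zero
  selected-toSelection o i j
    rewrite lookup∘tabulate (λ o → tabulate λ i → tabulate λ j → cornerOf (lookup w j) o i zero) o
          | lookup∘tabulate (λ i → tabulate λ j → cornerOf (lookup w j) o i zero) i
          = lookup∘tabulate (λ j → cornerOf (lookup w j) o i zero) j
  columns-lookup : ∀ {k} (w : Vec (Column m) k) → columns (λ o i j → cornerOf (lookup w j) o i zero) ≡ w
  columns-lookup [] = refl
  columns-lookup (c ∷ w) = cong₂ _∷_ (tabulate∘lookup c) (columns-lookup w)

cornerOf-columns : ∀ {m k} (S : Corners m k) o i j → cornerOf (lookup (columns S) j) o i zero ≡ S o i j
cornerOf-columns S horizontal i zero = cong proj₁ (lookup∘tabulate _ i)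
cornerOf-columns S vertical i zero = cong proj₂ (lookup∘tabulate _ i)
cornerOf-columns S o i (suc j) = cornerOf-columns (dropColumn S) o i j

Selection↔columns : ∀ {m k} → Selection m k ↔ Vec (Column m) k
Selection↔columns = mk↔ₛ′ (columns ∘ selected) toSelection columns-toSelection toSelection-columns
  where
  toSelection-columns : ∀ s → toSelection (columns (selected s)) ≡ s
  toSelection-columns s =
    trans (tabulate-cong λ o → trans (tabulate-cong λ i →
             trans (tabulate-cong λ j → cornerOf-columns (selected s) o i j) (tabulate∘lookup (lookup (lookup s o) i)))
           (tabulate∘lookup (lookup s o)))
      (tabulate∘lookup s)

sum-concatMap : ∀ {A : Set} (f : A → List ℕ) xs → sum (concatMap f xs) ≡ sum (map (sum ∘ f) xs)
sum-concatMap f [] = refl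
sum-concatMap f (x ∷ xs) = trans (sum-++ (f x) (concatMap f xs)) (cong (_+_ (sum (f x))) (sum-concatMap f xs))

sum-map-+ : ∀ {A : Set} (f g : A → ℕ) xs → sum (map (λ x → f x + g x) xs) ≡ sum (map f xs) + sum (map g xs)
sum-map-+ f g [] = refl
sum-map-+ f g (x ∷ xs) = trans (cong (_+_ (f x + g x)) (sum-map-+ f g xs)) (interchange (f x) (g x) _ _)
  where
  interchange : ∀ a b c d → (a + b) + (c + d) ≡ (a + c) + (b + d)
  interchange = solve-∀

sumFin : ∀ {k} → (Fin k → ℕ) → ℕ
sumFin {k} f = sum (map f (allFin k))

sumFin-cong : ∀ {k} {f g : Fin k → ℕ} → (∀ j → f j ≡ g j) → sumFin f ≡ sumFin g
sumFin-cong {k} f≡g = cong sum (map-cong f≡g (allFin k))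

sumFin-+ : ∀ {k} (f g : Fin k → ℕ) → sumFin (λ j → f j + g j) ≡ sumFin f + sumFin g
sumFin-+ {k} f g = sum-map-+ f g (allFin k)

sumFin-suc : ∀ {k} (f : Fin (suc k) → ℕ) → sumFin f ≡ f zero + sumFin (f ∘ suc)
sumFin-suc f = cong (_+_ (f zero)) (cong sum (trans (map-tabulate suc f) (sym (map-tabulate (λ j → j) (f ∘ suc)))))

sumFin-zero : ∀ {k} {f : Fin k → ℕ} → (∀ j → f j ≡ 0) → sumFin f ≡ 0
sumFin-zero {zero} f≡0 = refl
sumFin-zero {suc k} {f} f≡0 = trans (sumFin-suc f) (cong₂ _+_ (f≡0 zero) (sumFin-zero (f≡0 ∘ suc)))

sumTiles : ∀ {m} → (Fin 2 → Fin m → ℕ) → ℕ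
sumTiles F = sumFin λ o → sumFin λ i → F o i

sumTiles-cong : ∀ {m} {F G : Fin 2 → Fin m → ℕ} → (∀ o i → F o i ≡ G o i) → sumTiles F ≡ sumTiles G
sumTiles-cong F≡G = sumFin-cong λ o → sumFin-cong (F≡G o)

sumTiles-+ : ∀ {m} (F G : Fin 2 → Fin m → ℕ) → sumTiles (λ o i → F o i + G o i) ≡ sumTiles F + sumTiles G
sumTiles-+ F G =
  trans (sumFin-cong λ o → sumFin-+ (F o) (G o)) (sumFin-+ (λ o → sumFin (F o)) (λ o → sumFin (G o)))

-- Unlike in coverCount, the selection bit sits outside the test, so that for
-- concrete indices a term evaluates to bit (S o i j) or 0.
coverTerm : ∀ {m k} → Corners m k → Fin m → Fin k → Fin 2 → Fin m → Fin k → ℕ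
coverTerm S r c o i j = if covers o (toℕ i) (toℕ j) (toℕ r) (toℕ c) then bit (S o i j) else 0

coverage : ∀ {m k} → Corners m k → Fin m → Fin k → ℕ
coverage S r c = sumTiles λ o i → sumFin (coverTerm S r c o i)

coverCount-coverage : ∀ {m k} (s : Selection m k) r c → coverCount s r c ≡ coverage (selected s) r c
coverCount-coverage {m} {k} s r c =
  trans (sum-concatMap (λ o → concatMap (cellTerms o) (allFin m)) (allFin 2))
    (sumFin-cong λ o → trans (sum-concatMap (cellTerms o) (allFin m))
      (sumFin-cong λ i → sumFin-cong λ j → indicator (selected s o i j) (covers o (toℕ i) (toℕ j) (toℕ r) (toℕ c))))
  where
  cellTerms : Fin 2 → Fin m → List ℕ
  cellTerms o i = map (λ j → if selected s o i j ∧ covers o (toℕ i) (toℕ j) (toℕ r) (toℕ c) then 1 else 0) (allFin k)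
  indicator : ∀ b c → (if b ∧ c then 1 else 0) ≡ (if c then bit b else 0)
  indicator true true = refl
  indicator true false = refl
  indicator false true = refl
  indicator false false = refl

≤ᵇ-suc : ∀ m n → (suc m ≤ᵇ suc n) ≡ (m ≤ᵇ n)
≤ᵇ-suc zero n = refl
≤ᵇ-suc (suc m) n = refl

covers-suc : ∀ o i j r c → covers o i (suc j) r (suc c) ≡ covers o i j r c
covers-suc horizontal i j r c = cong (λ b → (r ≡ᵇ i) ∧ (b ∧ (c <ᵇ j + 3))) (≤ᵇ-suc j c)
covers-suc vertical i j r c = refl

covers-zero : ∀ o i j r → covers o i (suc j) r 0 ≡ false
covers-zero horizontal i j r = ∧-zeroʳ (r ≡ᵇ i)
covers-zero vertical i j r = refl

firstColumnCoverage : ∀ {m k} → Corners m (suc k) → Fin m → Fin (suc k) → ℕ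
firstColumnCoverage S r c = sumTiles λ o i → coverTerm S r c o i zero

coverage-zero : ∀ {m k} (S : Corners m (suc k)) r → coverage S r zero ≡ firstColumnCoverage S r zero
coverage-zero S r = sumTiles-cong λ o i →
  trans (sumFin-suc (coverTerm S r zero o i))
    (trans (cong (_+_ (coverTerm S r zero o i zero)) (sumFin-zero (beyond o i))) (+-identityʳ _))
  where
  beyond : ∀ o i j → coverTerm S r zero o i (suc j) ≡ 0
  beyond o i j rewrite covers-zero o (toℕ i) (toℕ j) (toℕ r) = refl

coverage-suc : ∀ {m k} (S : Corners m (suc k)) r c →
  coverage S r (suc c) ≡ firstColumnCoverage S r (suc c) + coverage (dropColumn S) r c
coverage-suc S r c =
  trans (sumTiles-cong λ o i → trans (sumFin-suc (coverTerm S r (suc c) o i))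
                                       (cong (_+_ (coverTerm S r (suc c) o i zero)) (sumFin-cong (shift o i))))
        (sumTiles-+ (λ o i → coverTerm S r (suc c) o i zero) (λ o i → sumFin (coverTerm (dropColumn S) r c o i)))
  where
  shift : ∀ o i j → coverTerm S r (suc c) o i (suc j) ≡ coverTerm (dropColumn S) r c o i j
  shift o i j rewrite covers-suc o (toℕ i) (toℕ j) (toℕ r) (toℕ c) = refl

pending : ∀ {m} → State m → Fin m → ℕ → ℕ
pending q r zero = bit (proj₁ (lookup q r)) + bit (proj₂ (lookup q r))
pending q r (suc zero) = bit (proj₂ (lookup q r))
pending q r (suc (suc _)) = 0

pendingFits : Bool × Bool → ℕ → Bool
pendingFits (a , b) zero = not (a ∨ b)
pendingFits (a , b) (suc zero) = not b
pendingFits _ (suc (suc _)) = true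

PendingFits : ∀ {m} → State m → ℕ → Set
PendingFits q k = ∀ r → T (pendingFits (lookup q r) k)

isFinal⇔PendingFits : ∀ {m} (q : State m) → T (isFinal q) ⇔ PendingFits q 0
isFinal⇔PendingFits [] = mk⇔ (λ _ ()) (λ _ → tt)
isFinal⇔PendingFits ((a , b) ∷ q) = mk⇔
  (λ t → let t₁ , t₂ = Equivalence.to (T-∧ {not (a ∨ b)}) t in
         λ { zero → t₁ ; (suc r) → Equivalence.to (isFinal⇔PendingFits q) t₂ r })
  (λ f → Equivalence.from (T-∧ {not (a ∨ b)}) (f zero , Equivalence.from (isFinal⇔PendingFits q) (f ∘ suc)))

HorizontalFit VerticalFit : ∀ {m k} → Corners m (suc k) → Set
HorizontalFit {k = k} S = ∀ i → T (S horizontal i zero) → T (3 ≤ᵇ suc k)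
VerticalFit {m} S = ∀ i → T (S vertical i zero) → T (toℕ i + 3 ≤ᵇ m)

TilesFit : ∀ {m k} → Corners m k → Set
TilesFit {m} {k} S = ∀ o i j → T (S o i j) → T (fits m k o (toℕ i) (toℕ j))

tilesFit-dropColumn⇔ : ∀ {m k} (S : Corners m (suc k)) →
  TilesFit S ⇔ (HorizontalFit S × VerticalFit S × TilesFit (dropColumn S))
tilesFit-dropColumn⇔ {m} {k} S = mk⇔
  (λ fit → (λ i → fit horizontal i zero) , (λ i → fit vertical i zero) ,
           (λ o i j → subst T (fits-suc o (toℕ i) (toℕ j)) ∘ fit o i (suc j)))
  (λ { (hfit , vfit , fit) horizontal i zero → hfit i
     ; (hfit , vfit , fit) vertical i zero → vfit i
     ; (hfit , vfit , fit) o i (suc j) → subst T (sym (fits-suc o (toℕ i) (toℕ j))) ∘ fit o i j })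
  where
  fits-suc : ∀ o i j → fits m (suc k) o i (suc j) ≡ fits m k o i j
  fits-suc horizontal i j = ≤ᵇ-suc (j + 3) k
  fits-suc vertical i j = refl

pendingFits-shift : ∀ a b h k →
  T (pendingFits (b , h) k) ⇔ (T (pendingFits (a , b) (suc k)) × (T h → T (3 ≤ᵇ suc k)))
pendingFits-shift a b h (suc (suc k)) = mk⇔ (λ _ → tt , λ _ → tt) (λ _ → tt)
pendingFits-shift a b false 1 = mk⇔ (λ _ → tt , λ ()) (λ _ → tt)
pendingFits-shift a b true 1 = mk⇔ (λ ()) (λ { (_ , h⇒⊥) → h⇒⊥ tt })
pendingFits-shift a false false 0 = mk⇔ (λ _ → tt , λ ()) (λ _ → tt)
pendingFits-shift a false true 0 = mk⇔ (λ ()) (λ { (_ , h⇒⊥) → h⇒⊥ tt })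
pendingFits-shift a true h 0 = mk⇔ (λ ()) (λ { (() , _) })

lookup-next : ∀ {m} (q : State m) (c : Column m) r →
  lookup (next q c) r ≡ (proj₂ (lookup q r) , proj₁ (lookup c r))
lookup-next ((a , b) ∷ q) ((h , v) ∷ c) zero = refl
lookup-next ((a , b) ∷ q) ((h , v) ∷ c) (suc r) = lookup-next q c r

pendingFits-next⇔ : ∀ {m k} (q : State m) (S : Corners m (suc k)) →
  (PendingFits q (suc k) × HorizontalFit S) ⇔ PendingFits (next q (firstColumn S)) k
pendingFits-next⇔ {k = k} q S = mk⇔
  (λ { (fit , hfit) r → subst (λ e → T (pendingFits e k)) (sym (lookup-next-first r))
                               (Equivalence.from (shift r) (fit r , hfit r)) })
  (λ fit′ → (λ r → proj₁ (Equivalence.to (shift r) (fit′ʳ fit′ r)))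
          , (λ r → proj₂ (Equivalence.to (shift r) (fit′ʳ fit′ r))))
  where
  lookup-next-first : ∀ r → lookup (next q (firstColumn S)) r ≡ (proj₂ (lookup q r) , S horizontal r zero)
  lookup-next-first r =
    trans (lookup-next q (firstColumn S) r) (cong (proj₂ (lookup q r) ,_) (cong proj₁ (lookup∘tabulate _ r)))
  shift : ∀ r → _
  shift r = pendingFits-shift (proj₁ (lookup q r)) (proj₂ (lookup q r)) (S horizontal r zero) k
  fit′ʳ : PendingFits (next q (firstColumn S)) k →
          ∀ r → T (pendingFits (proj₂ (lookup q r) , S horizontal r zero) k)
  fit′ʳ fit′ r = subst (λ e → T (pendingFits e k)) (lookup-next-first r) (fit′ r)

allᵛ : ∀ {A : Set} {n} → (A → Bool) → Vec A n → Bool → Bool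
allᵛ p [] e = e
allᵛ p (x ∷ xs) e = p x ∧ allᵛ p xs e

T-allᵛ⇔ : ∀ {A : Set} {n} (p : A → Bool) (xs : Vec A n) e →
  T (allᵛ p xs e) ⇔ ((∀ r → T (p (lookup xs r))) × T e)
T-allᵛ⇔ p [] e = mk⇔ (λ t → (λ ()) , t) proj₂
T-allᵛ⇔ p (x ∷ xs) e = mk⇔
  (λ t → let tx , txs = Equivalence.to (T-∧ {p x}) t
             all-xs , te = Equivalence.to (T-allᵛ⇔ p xs e) txs
         in (λ { zero → tx ; (suc r) → all-xs r }) , te)
  (λ { (all-x∷xs , te) →
         Equivalence.from (T-∧ {p x}) (all-x∷xs zero , Equivalence.from (T-allᵛ⇔ p xs e) (all-x∷xs ∘ suc , te)) })

FirstColumnCovered : ∀ {m k} → State m → Corners m (suc k) → Set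
FirstColumnCovered q S = ∀ r → pending q r 0 + coverage S r zero ≡ 1

CoveredOnce : ∀ {m k} → State m → Corners m k → Set
CoveredOnce q S = ∀ r c → pending q r (toℕ c) + coverage S r c ≡ 1

verticalFit⇔ : ∀ {k} (S : Corners 5 (suc k)) →
  VerticalFit S ⇔ ((T (S vertical 3F zero) → ⊥) × (T (S vertical 4F zero) → ⊥))
verticalFit⇔ S = mk⇔ (λ vfit → vfit 3F , vfit 4F)
  (λ { _ 0F _ → tt ; _ 1F _ → tt ; _ 2F _ → tt ; (no₃ , _) 3F → no₃ ; (_ , no₄) 4F → no₄ })

neither⇔ : ∀ a b → ((T a → ⊥) × (T b → ⊥)) ⇔ T (not (b ∨ a))
neither⇔ false false = mk⇔ (λ _ → tt) (λ _ → (λ ()) , (λ ()))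
neither⇔ false true = mk⇔ (λ { (_ , no-b) → no-b tt }) (λ ())
neither⇔ true false = mk⇔ (λ { (no-a , _) → no-a tt }) (λ ())
neither⇔ true true = mk⇔ (λ { (no-a , _) → no-a tt }) (λ ())

-- Left-hand sides: the normal forms of pending q r c + firstColumnCoverage S r c
-- at concrete r and c.
column0-count : ∀ a b h v x y → (a + b) + ((h + 0) + ((y + (x + (v + 0))) + 0)) ≡ a + b + h + v + x + y
column0-count = solve-∀

column1-count : ∀ b h → b + ((h + 0) + 0) ≡ b + h
column1-count = solve-∀

pending-firstColumn : ∀ {k} (q : State 5) (S : Corners 5 (suc k)) r (c : Fin k) →
  pending q r (suc (toℕ c)) + firstColumnCoverage S r (suc c) ≡ pending (next q (firstColumn S)) r (toℕ c)
pending-firstColumn (_ ∷ _ ∷ _ ∷ _ ∷ _ ∷ []) S 0F (suc (suc c)) = refl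
pending-firstColumn (_ ∷ _ ∷ _ ∷ _ ∷ _ ∷ []) S 1F (suc (suc c)) = refl
pending-firstColumn (_ ∷ _ ∷ _ ∷ _ ∷ _ ∷ []) S 2F (suc (suc c)) = refl
pending-firstColumn (_ ∷ _ ∷ _ ∷ _ ∷ _ ∷ []) S 3F (suc (suc c)) = refl
pending-firstColumn (_ ∷ _ ∷ _ ∷ _ ∷ _ ∷ []) S 4F (suc (suc c)) = refl
pending-firstColumn (_ ∷ _ ∷ _ ∷ _ ∷ _ ∷ []) S 0F 1F = column1-count 0 _
pending-firstColumn (_ ∷ _ ∷ _ ∷ _ ∷ _ ∷ []) S 1F 1F = column1-count 0 _
pending-firstColumn (_ ∷ _ ∷ _ ∷ _ ∷ _ ∷ []) S 2F 1F = column1-count 0 _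
pending-firstColumn (_ ∷ _ ∷ _ ∷ _ ∷ _ ∷ []) S 3F 1F = column1-count 0 _
pending-firstColumn (_ ∷ _ ∷ _ ∷ _ ∷ _ ∷ []) S 4F 1F = column1-count 0 _
pending-firstColumn ((_ , b) ∷ _ ∷ _ ∷ _ ∷ _ ∷ []) S 0F 0F = column1-count (bit b) _
pending-firstColumn (_ ∷ (_ , b) ∷ _ ∷ _ ∷ _ ∷ []) S 1F 0F = column1-count (bit b) _
pending-firstColumn (_ ∷ _ ∷ (_ , b) ∷ _ ∷ _ ∷ []) S 2F 0F = column1-count (bit b) _
pending-firstColumn (_ ∷ _ ∷ _ ∷ (_ , b) ∷ _ ∷ []) S 3F 0F = column1-count (bit b) _
pending-firstColumn (_ ∷ _ ∷ _ ∷ _ ∷ (_ , b) ∷ []) S 4F 0F = column1-count (bit b) _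

valid-firstColumn⇔ : ∀ {k} (q : State 5) (S : Corners 5 (suc k)) →
  T (valid q false false (firstColumn S)) ⇔ (FirstColumnCovered q S × VerticalFit S)
valid-firstColumn⇔ q@((a₀ , b₀) ∷ (a₁ , b₁) ∷ (a₂ , b₂) ∷ (a₃ , b₃) ∷ (a₄ , b₄) ∷ []) S = mk⇔
  (λ t → let rowsOK , lastOK = Equivalence.to allRows t
         in (λ r → trans (row r) (≡ᵇ⇒≡ _ 1 (rowsOK r))) , Equivalence.from lastRows lastOK)
  (λ { (cov , vfit) → Equivalence.from allRows
         ((λ r → ≡⇒≡ᵇ _ 1 (trans (sym (row r)) (cov r))) , Equivalence.to lastRows vfit) })
  where
  h v : Fin 5 → ℕ
  h i = bit (S horizontal i zero)
  v i = bit (S vertical i zero)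
  counts : Vec ℕ 5
  counts = bit a₀ + bit b₀ + h 0F + v 0F + 0 + 0
         ∷ bit a₁ + bit b₁ + h 1F + v 1F + v 0F + 0
         ∷ bit a₂ + bit b₂ + h 2F + v 2F + v 1F + v 0F
         ∷ bit a₃ + bit b₃ + h 3F + v 3F + v 2F + v 1F
         ∷ bit a₄ + bit b₄ + h 4F + v 4F + v 3F + v 2F ∷ []
  noVerticalBelow : Bool
  noVerticalBelow = not (S vertical 4F zero ∨ S vertical 3F zero)
  allRows : T (allᵛ (_≡ᵇ 1) counts noVerticalBelow) ⇔ ((∀ r → T (lookup counts r ≡ᵇ 1)) × T noVerticalBelow)
  allRows = T-allᵛ⇔ (_≡ᵇ 1) counts noVerticalBelow
  lastRows : VerticalFit S ⇔ T noVerticalBelow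
  lastRows = ⇔-trans (verticalFit⇔ S) (neither⇔ (S vertical 3F zero) (S vertical 4F zero))
  rowCount : ∀ r → pending q r 0 + firstColumnCoverage S r zero ≡ lookup counts r
  rowCount 0F = column0-count (bit a₀) (bit b₀) (h 0F) (v 0F) 0 0
  rowCount 1F = column0-count (bit a₁) (bit b₁) (h 1F) (v 1F) (v 0F) 0
  rowCount 2F = column0-count (bit a₂) (bit b₂) (h 2F) (v 2F) (v 1F) (v 0F)
  rowCount 3F = column0-count (bit a₃) (bit b₃) (h 3F) (v 3F) (v 2F) (v 1F)
  rowCount 4F = column0-count (bit a₄) (bit b₄) (h 4F) (v 4F) (v 3F) (v 2F)
  row : ∀ r → pending q r 0 + coverage S r zero ≡ lookup counts r
  row r = trans (cong (_+_ (pending q r 0)) (coverage-zero S r)) (rowCount r)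

pending-coverage-suc : ∀ {k} (q : State 5) (S : Corners 5 (suc k)) r c →
  pending q r (suc (toℕ c)) + coverage S r (suc c)
    ≡ pending (next q (firstColumn S)) r (toℕ c) + coverage (dropColumn S) r c
pending-coverage-suc q S r c = begin
  pending q r (suc (toℕ c)) + coverage S r (suc c)
    ≡⟨ cong (_+_ (pending q r (suc (toℕ c)))) (coverage-suc S r c) ⟩
  pending q r (suc (toℕ c)) + (firstColumnCoverage S r (suc c) + coverage (dropColumn S) r c)
    ≡⟨ sym (+-assoc (pending q r (suc (toℕ c))) _ _) ⟩
  pending q r (suc (toℕ c)) + firstColumnCoverage S r (suc c) + coverage (dropColumn S) r c
    ≡⟨ cong (_+ coverage (dropColumn S) r c) (pending-firstColumn q S r c) ⟩
  pending (next q (firstColumn S)) r (toℕ c) + coverage (dropColumn S) r c ∎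
  where open ≡-Reasoning

coveredOnce-dropColumn⇔ : ∀ {k} (q : State 5) (S : Corners 5 (suc k)) →
  CoveredOnce q S ⇔ (FirstColumnCovered q S × CoveredOnce (next q (firstColumn S)) (dropColumn S))
coveredOnce-dropColumn⇔ q S = mk⇔
  (λ cov → (λ r → cov r zero) , (λ r c → trans (sym (pending-coverage-suc q S r c)) (cov r (suc c))))
  (λ { (cov₀ , cov′) r zero → cov₀ r
     ; (cov₀ , cov′) r (suc c) → trans (pending-coverage-suc q S r c) (cov′ r c) })

accepts-columns⇔ : ∀ {k} (q : State 5) (S : Corners 5 k) →
  T (accepts q (columns S)) ⇔ (PendingFits q k × TilesFit S × CoveredOnce q S)
accepts-columns⇔ {zero} q S = mk⇔
  (λ t → Equivalence.to (isFinal⇔PendingFits q) t , (λ _ _ ()) , (λ _ ()))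
  (λ { (fit , _) → Equivalence.from (isFinal⇔PendingFits q) fit })
accepts-columns⇔ {suc k} q S = mk⇔
  (λ t → let validOK , rest = Equivalence.to (T-∧ {valid q false false (firstColumn S)}) t
             cov₀ , vfit = Equivalence.to (valid-firstColumn⇔ q S) validOK
             fit′ , tiles′ , cov′ = Equivalence.to (accepts-columns⇔ q′ (dropColumn S)) rest
             fit , hfit = Equivalence.from (pendingFits-next⇔ q S) fit′
         in fit , Equivalence.from (tilesFit-dropColumn⇔ S) (hfit , vfit , tiles′)
                , Equivalence.from (coveredOnce-dropColumn⇔ q S) (cov₀ , cov′))
  (λ { (fit , tiles , cov) →
       let hfit , vfit , tiles′ = Equivalence.to (tilesFit-dropColumn⇔ S) tiles
           cov₀ , cov′ = Equivalence.to (coveredOnce-dropColumn⇔ q S) cov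
       in Equivalence.from (T-∧ {valid q false false (firstColumn S)})
            ( Equivalence.from (valid-firstColumn⇔ q S) (cov₀ , vfit)
            , Equivalence.from (accepts-columns⇔ q′ (dropColumn S))
                (Equivalence.to (pendingFits-next⇔ q S) (fit , hfit) , tiles′ , cov′)) })
  where
  q′ : State 5
  q′ = next q (firstColumn S)

T-all-allFin⇔ : ∀ {k} (p : Fin k → Bool) → T (all p (allFin k)) ⇔ (∀ i → T (p i))
T-all-allFin⇔ p = mk⇔ (tabulate⁻ ∘ all⁺ p _) (all⁻ p ∘ tabulate⁺)

T-if⇔ : ∀ b c → T (if b then c else true) ⇔ (T b → T c)
T-if⇔ true c = mk⇔ (λ t _ → t) (λ f → f tt)
T-if⇔ false c = mk⇔ (λ _ ()) (λ _ → tt)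

isTiling⇔ : ∀ {m k} (s : Selection m k) →
  T (isTiling m k s) ⇔ (TilesFit (selected s) × (∀ r c → coverCount s r c ≡ 1))
isTiling⇔ {m} {k} s = ⇔-trans T-∧ (fit⇔ ×-⇔ cover⇔)
  where
  S : Corners m k
  S = selected s
  open Equivalence
  fitsIfSelected : Fin 2 → Fin m → Fin k → Bool
  fitsIfSelected o i j = if S o i j then fits m k o (toℕ i) (toℕ j) else true
  rowFits : Fin 2 → Fin m → Bool
  rowFits o i = all (fitsIfSelected o i) (allFin k)
  orientationFits : Fin 2 → Bool
  orientationFits o = all (rowFits o) (allFin m)
  fit⇔ : T (all orientationFits (allFin 2)) ⇔ TilesFit S
  fit⇔ = mk⇔
    (λ t o i j → to (T-if⇔ (S o i j) _) (to (T-all-allFin⇔ (fitsIfSelected o i))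
                   (to (T-all-allFin⇔ (rowFits o)) (to (T-all-allFin⇔ orientationFits) t o) i) j))
    (λ tiles → from (T-all-allFin⇔ orientationFits) λ o → from (T-all-allFin⇔ (rowFits o)) λ i →
                 from (T-all-allFin⇔ (fitsIfSelected o i)) λ j → from (T-if⇔ (S o i j) _) (tiles o i j))
  rowCovered : Fin m → Bool
  rowCovered r = all (λ c → coverCount s r c ≡ᵇ 1) (allFin k)
  cover⇔ : T (all rowCovered (allFin m)) ⇔ (∀ r c → coverCount s r c ≡ 1)
  cover⇔ = mk⇔
    (λ t r c → ≡ᵇ⇒≡ _ 1 (to (T-all-allFin⇔ _) (to (T-all-allFin⇔ rowCovered) t r) c))
    (λ cover → from (T-all-allFin⇔ rowCovered) λ r → from (T-all-allFin⇔ _) λ c → ≡⇒≡ᵇ _ 1 (cover r c))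

pending-empty : ∀ {m} (r : Fin m) c → pending empty r c ≡ 0
pending-empty r zero = cong (λ e → bit (proj₁ e) + bit (proj₂ e)) (lookup-replicate r (false , false))
pending-empty r (suc zero) = cong (bit ∘ proj₂) (lookup-replicate r (false , false))
pending-empty r (suc (suc c)) = refl

pendingFits-empty : ∀ {m} k → PendingFits (empty {m}) k
pendingFits-empty k r = subst (λ e → T (pendingFits e k)) (sym (lookup-replicate r (false , false))) (emptyFits k)
  where
  emptyFits : ∀ k → T (pendingFits (false , false) k)
  emptyFits zero = tt
  emptyFits (suc zero) = tt
  emptyFits (suc (suc k)) = tt

isTiling⇔accepts : ∀ {k} (s : Selection 5 k) → T (isTiling 5 k s) ⇔ T (accepts empty (columns (selected s)))
isTiling⇔accepts {k} s = mk⇔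
  (λ t → let tiles , cover = to (isTiling⇔ s) t
         in from (accepts-columns⇔ empty S) (pendingFits-empty k , tiles , λ r c →
              trans (cong₂ _+_ (pending-empty r (toℕ c)) (sym (coverCount-coverage s r c))) (cover r c)))
  (λ t → let _ , tiles , cover = to (accepts-columns⇔ empty S) t
         in from (isTiling⇔ s) (tiles , λ r c →
              trans (trans (coverCount-coverage s r c) (cong (_+ coverage S r c) (sym (pending-empty r (toℕ c)))))
                    (cover r c)))
  where
  S : Corners 5 k
  S = selected s
  open Equivalence

T-⇔⇒↔ : ∀ {a b} → T a ⇔ T b → T a ↔ T b
T-⇔⇒↔ a⇔b =
  mk↔ₛ′ (Equivalence.to a⇔b) (Equivalence.from a⇔b) (λ _ → T-irrelevant _ _) (λ _ → T-irrelevant _ _)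

Tiling↔Accepted : ∀ {k} → Tiling 5 k ↔ Accepted k empty
Tiling↔Accepted = Σ-↔ Selection↔columns (λ {s} → T-⇔⇒↔ (isTiling⇔accepts s))

-- The generating series

-- The coefficients of B(z⁵), where B is the generating function of b.
dilate₅ : (ℕ → ℕ) → ℕ → ℕ
dilate₅ b 0 = b 0
dilate₅ b 1 = 0
dilate₅ b 2 = 0
dilate₅ b 3 = 0
dilate₅ b 4 = 0
dilate₅ b (suc (suc (suc (suc (suc N))))) = dilate₅ (b ∘ suc) N

dilate₅-multiple : ∀ b j → dilate₅ b (j * 5) ≡ b j
dilate₅-multiple b zero = refl
dilate₅-multiple b (suc j) = dilate₅-multiple (b ∘ suc) j

dilate₅-nonmultiple : ∀ b N → ¬ 5 ∣ N → dilate₅ b N ≡ 0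
dilate₅-nonmultiple b 0 5∤0 with () ← 5∤0 (divides 0 refl)
dilate₅-nonmultiple b 1 _ = refl
dilate₅-nonmultiple b 2 _ = refl
dilate₅-nonmultiple b 3 _ = refl
dilate₅-nonmultiple b 4 _ = refl
dilate₅-nonmultiple b (suc (suc (suc (suc (suc N))))) 5∤5+N =
  dilate₅-nonmultiple (b ∘ suc) N (5∤5+N ∘ ∣m∣n⇒∣m+n ∣-refl)

Recurrence₅ : (ℕ → ℕ) → Set
Recurrence₅ f = ∀ N → 3 * f (5 + N) + f (15 + N) ≡ 6 * f (10 + N) + f N

dilate₅-recurrence : ∀ b → (∀ j → 3 * b (1 + j) + b (3 + j) ≡ 6 * b (2 + j) + b j) →
  Recurrence₅ (dilate₅ b)
dilate₅-recurrence b rec 0 = rec 0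
dilate₅-recurrence b rec 1 = refl
dilate₅-recurrence b rec 2 = refl
dilate₅-recurrence b rec 3 = refl
dilate₅-recurrence b rec 4 = refl
dilate₅-recurrence b rec (suc (suc (suc (suc (suc N))))) = dilate₅-recurrence (b ∘ suc) (rec ∘ suc) N

⊛-suc : ∀ (f g : Series) N → (f ⊛ g) (suc N) ≡ f 0 ℤ.* g (suc N) ℤ.+ ((f ∘ suc) ⊛ g) N
⊛-suc f g N = cong (λ xs → f 0 ℤ.* g (suc N) ℤ.+ foldr ℤ._+_ (+ 0) xs)
  (trans (map-applyUpTo suc term (suc N)) (sym (map-applyUpTo (λ k → k) (term ∘ suc) (suc N))))
  where
  term : ℕ → ℤ
  term k = f k ℤ.* g (suc N ∸ k)

⊛-shift : ∀ (f g : Series) d → (∀ o → g (suc d + o) ≡ + 0) →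
  ∀ M → (f ⊛ g) (M + d) ≡ ((λ t → f (M + t)) ⊛ g) d
⊛-shift f g d g≡0 zero = refl
⊛-shift f g d g≡0 (suc M) = begin
  (f ⊛ g) (suc (M + d))
    ≡⟨ ⊛-suc f g (M + d) ⟩
  f 0 ℤ.* g (suc (M + d)) ℤ.+ ((f ∘ suc) ⊛ g) (M + d)
    ≡⟨ cong₂ ℤ._+_ vanishing (⊛-shift (f ∘ suc) g d g≡0 M) ⟩
  + 0 ℤ.+ ((λ t → f (suc (M + t))) ⊛ g) d
    ≡⟨ ℤ.+-identityˡ _ ⟩
  ((λ t → f (suc M + t)) ⊛ g) d ∎
  where
  open ≡-Reasoning
  vanishing : f 0 ℤ.* g (suc (M + d)) ≡ + 0
  vanishing =
    trans (cong (λ n → f 0 ℤ.* g (suc n)) (+-comm M d)) (trans (cong (f 0 ℤ.*_) (g≡0 M)) (ℤ.*-zeroʳ (f 0)))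

denominator-vanishes : ∀ o → denominator (16 + o) ≡ + 0
denominator-vanishes o = refl

-- Of the sixteen terms of the convolution only those at 0, 5, 10, 15 survive.
denominator-window : ∀ (x : Series) → (x ⊛ denominator) 15 ≡ x 15 ℤ.- + 6 ℤ.* x 10 ℤ.+ + 3 ℤ.* x 5 ℤ.- x 0
denominator-window x =
  trans (cong (λ r → x 0 ℤ.* ℤ.- + 1 ℤ.+ r)
          (trans (dropZeros (x 1) (x 2) (x 3) (x 4) _) (cong (λ r → x 5 ℤ.* + 3 ℤ.+ r)
            (trans (dropZeros (x 6) (x 7) (x 8) (x 9) _) (cong (λ r → x 10 ℤ.* ℤ.- + 6 ℤ.+ r)
              (dropZeros (x 11) (x 12) (x 13) (x 14) _))))))
        (collect (x 0) (x 5) (x 10) (x 15))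
  where
  dropZeros : ∀ a b c d y → a ℤ.* + 0 ℤ.+ (b ℤ.* + 0 ℤ.+ (c ℤ.* + 0 ℤ.+ (d ℤ.* + 0 ℤ.+ y))) ≡ y
  dropZeros = ℤ.solve-∀
  collect : ∀ x₀ x₅ x₁₀ x₁₅ →
    x₀ ℤ.* ℤ.- + 1 ℤ.+ (x₅ ℤ.* + 3 ℤ.+ (x₁₀ ℤ.* ℤ.- + 6 ℤ.+ (x₁₅ ℤ.* + 1 ℤ.+ + 0)))
      ≡ x₁₅ ℤ.- + 6 ℤ.* x₁₀ ℤ.+ + 3 ℤ.* x₅ ℤ.- x₀
  collect = ℤ.solve-∀

recurrence⇒ℤ : ∀ x₀ x₅ x₁₀ x₁₅ → 3 * x₅ + x₁₅ ≡ 6 * x₁₀ + x₀ →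
  + x₁₅ ℤ.- + 6 ℤ.* + x₁₀ ℤ.+ + 3 ℤ.* + x₅ ℤ.- + x₀ ≡ + 0
recurrence⇒ℤ x₀ x₅ x₁₀ x₁₅ eq = begin
  + x₁₅ ℤ.- + 6 ℤ.* + x₁₀ ℤ.+ + 3 ℤ.* + x₅ ℤ.- + x₀
    ≡⟨ regroup (+ x₀) (+ x₅) (+ x₁₀) (+ x₁₅) ⟩
  (+ 3 ℤ.* + x₅ ℤ.+ + x₁₅) ℤ.- (+ 6 ℤ.* + x₁₀ ℤ.+ + x₀)
    ≡⟨ cong₂ ℤ._-_ (sym (pos-linear 3 x₅ x₁₅)) (sym (pos-linear 6 x₁₀ x₀)) ⟩
  + (3 * x₅ + x₁₅) ℤ.- + (6 * x₁₀ + x₀)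
    ≡⟨ cong (λ n → + n ℤ.- + (6 * x₁₀ + x₀)) eq ⟩
  + (6 * x₁₀ + x₀) ℤ.- + (6 * x₁₀ + x₀)
    ≡⟨ ℤ.+-inverseʳ (+ (6 * x₁₀ + x₀)) ⟩
  + 0 ∎
  where
  open ≡-Reasoning
  regroup : ∀ a b c d → d ℤ.- + 6 ℤ.* c ℤ.+ + 3 ℤ.* b ℤ.- a ≡ (+ 3 ℤ.* b ℤ.+ d) ℤ.- (+ 6 ℤ.* c ℤ.+ a)
  regroup = ℤ.solve-∀
  pos-linear : ∀ c x y → + (c * x + y) ≡ + c ℤ.* + x ℤ.+ + y
  pos-linear c x y = trans (ℤ.pos-+ (c * x) y) (cong (ℤ._+ + y) (ℤ.pos-* c x))

denominator-annihilates : ∀ f → Recurrence₅ f → ∀ M → ((λ n → + f n) ⊛ denominator) (M + 15) ≡ + 0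
denominator-annihilates f rec M = begin
  ((λ n → + f n) ⊛ denominator) (M + 15)
    ≡⟨ ⊛-shift (λ n → + f n) denominator 15 denominator-vanishes M ⟩
  ((λ t → + f (M + t)) ⊛ denominator) 15
    ≡⟨ denominator-window (λ t → + f (M + t)) ⟩
  + f (M + 15) ℤ.- + 6 ℤ.* + f (M + 10) ℤ.+ + 3 ℤ.* + f (M + 5) ℤ.- + f (M + 0)
    ≡⟨ recurrence⇒ℤ (f (M + 0)) (f (M + 5)) (f (M + 10)) (f (M + 15)) shiftedRec ⟩
  + 0 ∎
  where
  open ≡-Reasoning
  shiftedRec : 3 * f (M + 5) + f (M + 15) ≡ 6 * f (M + 10) + f (M + 0)
  shiftedRec rewrite +-comm M 5 | +-comm M 15 | +-comm M 10 | +-identityʳ M = rec M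

tilingCount : ℕ → ℕ
tilingCount = dilate₅ λ j → countAccepted (j * 3) (empty {5})

tilingCount-recurrence : Recurrence₅ tilingCount
tilingCount-recurrence = dilate₅-recurrence _ λ j → countAccepted-recurrence (j * 3) empty

3*N≡5*k⇒5∣N : ∀ N k → 3 * N ≡ 5 * k → 5 ∣ N
3*N≡5*k⇒5∣N N k 3N≡5k = coprime-divisor (from-yes (coprime? 5 3)) (divides k (trans 3N≡5k (*-comm 5 k)))

Tiling↔Fin-tilingCount : ∀ N k → 3 * N ≡ 5 * k → Tiling 5 k ↔ Fin (tilingCount N)
Tiling↔Fin-tilingCount N k 3N≡5k with divides j refl ← 3*N≡5*k⇒5∣N N k 3N≡5k =
  subst (λ n → Tiling 5 k ↔ Fin n) (sym count≡) (↔-trans Tiling↔Accepted (Accepted↔Fin k empty))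
  where
  k≡j*3 : k ≡ j * 3
  k≡j*3 = *-cancelˡ-≡ k (j * 3) 5 (trans (sym 3N≡5k) (commute j))
    where
    commute : ∀ j → 3 * (j * 5) ≡ 5 * (j * 3)
    commute = solve-∀
  count≡ : tilingCount (j * 5) ≡ countAccepted k empty
  count≡ = trans (dilate₅-multiple _ j) (cong (λ w → countAccepted w empty) (sym k≡j*3))

tilingCount-nonmultiple : ∀ N → ¬ 5 ∣ 3 * N → tilingCount N ≡ 0
tilingCount-nonmultiple N 5∤3N = dilate₅-nonmultiple _ N λ 5∣N → 5∤3N (∣-trans 5∣N (n∣m*n 3))

generatingSeries : Series
generatingSeries n = + tilingCount n

MatchesNumerator : ℕ → Set
MatchesNumerator n = (generatingSeries ⊛ denominator) n ≡ numerator n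

matchesNumerator-<15 : ∀ (i : Fin 15) → MatchesNumerator (toℕ i)
matchesNumerator-<15 =
  from-yes (all? {P = MatchesNumerator ∘ toℕ} λ (i : Fin 15) →
    (generatingSeries ⊛ denominator) (toℕ i) ℤ.≟ numerator (toℕ i))

matchesNumerator-15+ : ∀ M → MatchesNumerator (15 + M)
matchesNumerator-15+ M = begin
  (generatingSeries ⊛ denominator) (15 + M) ≡⟨ cong (generatingSeries ⊛ denominator) (+-comm 15 M) ⟩
  (generatingSeries ⊛ denominator) (M + 15) ≡⟨ denominator-annihilates tilingCount tilingCount-recurrence M ⟩
  + 0                                       ≡⟨ sym (numerator-tail M) ⟩
  numerator (15 + M)                        ∎
  where
  open ≡-Reasoning
  numerator-tail : ∀ M → numerator (15 + M) ≡ + 0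
  numerator-tail zero = refl
  numerator-tail (suc M) = refl

matchesNumerator : ∀ N → MatchesNumerator N
matchesNumerator N with N <? 15
... | yes N<15 = subst MatchesNumerator (toℕ-fromℕ< N<15) (matchesNumerator-<15 (fromℕ< N<15))
... | no N≮15 = subst MatchesNumerator (proj₂ N≥15) (matchesNumerator-15+ (proj₁ N≥15))
  where
  N≥15 : Σ ℕ λ M → 15 + M ≡ N
  N≥15 = m≤n⇒∃[o]m+o≡n (≮⇒≥ N≮15)

mainTheorem2 : Σ (ℕ → ℕ) (λ a →
    (a 0 ≡ 1)
    × (∀ N k → 3 * N ≡ 5 * k → 0 < k → Tiling 5 k ↔ Fin (a N))
    × (∀ N → ¬ (5 ∣ 3 * N) → a N ≡ 0)
    × (∀ N → ((λ n → + (a n)) ⊛ denominator) N ≡ numerator N)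
    × (a 5 ≡ 4) × (a 10 ≡ 22) × (a 15 ≡ 121) × (a 20 ≡ 664))
mainTheorem2 =
  tilingCount , refl , (λ N k 3N≡5k _ → Tiling↔Fin-tilingCount N k 3N≡5k) ,
  tilingCount-nonmultiple , matchesNumerator ,
  refl , refl , refl , refl
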